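{- Let $G=(\mathcal{A}\cup\mathcal{B},E)$ be a bipartite graph in which every vertex $v$ has a lower quota $q^-(v)\in\mathbb{Z}_{\ge0}$ and an upper quota $q^+(v)\in\mathbb{Z}_{>0}$ with $q^-(v)\le q^+(v)$. Let $N_1$ be any critical matching of $G$ and $N_2$ be any matching of $G$. Then $\mathrm{Def}_{\mathcal{A}}(N_1)\le \mathrm{Def}_{\mathcal{A}}(N_2)$ and $\mathrm{Def}_{\mathcal{B}}(N_1)\le \mathrm{Def}_{\mathcal{B}}(N_2)$.
   Context: A matching in $G$ is a set $M\subseteq E$ with $|M(v)|\le q^+(v)$ for every vertex $v$, where $M(v)$ denotes the set of neighbors of $v$ matched to $v$ in $M$. For a matching $M$, $\mathrm{Def}_{\mathcal{A}}(M)=\sum_{a\in\mathcal{A}}\max\{0,q^-(a)-|M(a)|\}$, $\mathrm{Def}_{\mathcal{B}}(M)=\sum_{b\in\mathcal{B}}\max\{0,q^-(b)-|M(b)|\}$, and $\mathrm{Def}(M)=\mathrm{Def}_{\mathcal{A}}(M)+\mathrm{Def}_{\mathcal{B}}(M)$. A matching $M$ is critical if there is no matching $N$ of $G$ with $\mathrm{Def}(N)<\mathrm{Def}(M)$. -}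

module Defs where

open import Data.Nat using (ℕ; zero; suc; _+_; _∸_; _≤_; _<_)
open import Data.Bool using (Bool; true; false; T)
open import Data.Fin using (Fin)
open import Data.Product using (_×_)
open import Relation.Nullary using (¬_)

count : (n : ℕ) → (Fin n → Bool) → ℕ
count zero    P = 0
count (suc n) P with P Fin.zero
... | true  = suc (count n (λ i → P (Fin.suc i)))
... | false = count n (λ i → P (Fin.suc i))

sumFin : (n : ℕ) → (Fin n → ℕ) → ℕ
sumFin zero    f = 0
sumFin (suc n) f = f Fin.zero + sumFin n (λ i → f (Fin.suc i))

record Instance (nA nB : ℕ) : Set where
  field
    E    : Fin nA → Fin nB → Bool
    q⁻A  : Fin nA → ℕ
    q⁺A  : Fin nA → ℕ
    q⁻B  : Fin nB → ℕ
    q⁺B  : Fin nB → ℕ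

record WellQuoted {nA nB : ℕ} (G : Instance nA nB) : Set where
  open Instance G
  field
    lowA≤upA : ∀ a → q⁻A a ≤ q⁺A a
    lowB≤upB : ∀ b → q⁻B b ≤ q⁺B b
    upA-pos  : ∀ a → 0 < q⁺A a
    upB-pos  : ∀ b → 0 < q⁺B b

EdgeSet : ℕ → ℕ → Set
EdgeSet nA nB = Fin nA → Fin nB → Bool

degA : {nA nB : ℕ} → EdgeSet nA nB → Fin nA → ℕ
degA {nA} {nB} M a = count nB (λ b → M a b)

degB : {nA nB : ℕ} → EdgeSet nA nB → Fin nB → ℕ
degB {nA} {nB} M b = count nA (λ a → M a b)

record IsMatching {nA nB : ℕ} (G : Instance nA nB) (M : EdgeSet nA nB) : Set where
  open Instance G
  field
    ⊆E    : ∀ a b → T (M a b) → T (E a b)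
    capA  : ∀ a → degA M a ≤ q⁺A a
    capB  : ∀ b → degB M b ≤ q⁺B b

-- Def_𝒜(M) = Σ_a max{0, q⁻(a) − |M(a)|}  (truncated subtraction ∸ is exactly max{0, ·})
DefA : {nA nB : ℕ} → Instance nA nB → EdgeSet nA nB → ℕ
DefA {nA} G M = sumFin nA (λ a → Instance.q⁻A G a ∸ degA M a)

DefB : {nA nB : ℕ} → Instance nA nB → EdgeSet nA nB → ℕ
DefB {nA} {nB} G M = sumFin nB (λ b → Instance.q⁻B G b ∸ degB M b)

Def : {nA nB : ℕ} → Instance nA nB → EdgeSet nA nB → ℕ
Def G M = DefA G M + DefB G M

record IsCritical {nA nB : ℕ} (G : Instance nA nB) (M : EdgeSet nA nB) : Set where
  field
    matching : IsMatching G M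
    minimal  : ∀ (N : EdgeSet nA nB) → IsMatching G N → ¬ (Def G N < Def G M)

{-# OPTIONS --safe #-}
-- Suppose a critical N₁ had DefA N₁ > DefA N₂. Then some a ∈ 𝒜 is deficient in N₁ and
-- has fewer N₁-edges than N₂-edges, so some ab ∈ N₂ ∖ N₁. If b is unsaturated in N₁,
-- adding ab lowers Def. Otherwise b, after adding ab, has more edges than in N₂, so
-- some a'b ∈ N₁ ∖ N₂, and exchanging a'b for ab keeps DefB and does not raise DefA;
-- by criticality Def and DefA are unchanged. This gives a critical matching with the
-- same DefA that is strictly closer to N₂, so induction on the Hamming distance to N₂
-- yields DefA N₁ ≤ DefA N₂. The ℬ side follows by swapping the two vertex classes.
module Submission where

open import Defs
open import Data.Nat using (ℕ; zero; suc; _+_; _∸_; _≤_; _<_; z≤n; s≤s; _≤?_; _<?_)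
open import Data.Nat.Properties hiding (_≟_)
open import Data.Nat.Induction using (<-wellFounded)
open import Algebra.Properties.CommutativeSemigroup +-commutativeSemigroup using (xy∙z≈zy∙x)
open import Data.Bool using (Bool; true; false; not; T; if_then_else_; _∧_; _xor_)
open import Data.Bool.Properties using (xor-same; xor-inverseˡ)
open import Data.Fin using (Fin; zero; suc)
open import Data.Fin.Properties using (_≟_) renaming (suc-injective to Fin-suc-injective)
open import Data.Product using (_×_; _,_; ∃-syntax)
open import Data.Sum using ([_,_]′)
open import Data.Unit using (tt)
open import Data.Empty using (⊥-elim)
open import Function using (_∘_; const)
open import Induction.WellFounded using (Acc; acc)
open import Relation.Nullary using (Dec; yes; no; does)
open import Relation.Binary.PropositionalEquality

sumFin-cong : ∀ n {f g : Fin n → ℕ} → (∀ i → f i ≡ g i) → sumFin n f ≡ sumFin n g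
sumFin-cong zero    f≡g = refl
sumFin-cong (suc n) f≡g = cong₂ _+_ (f≡g zero) (sumFin-cong n (f≡g ∘ suc))

sumFin-mono-≤ : ∀ n {f g : Fin n → ℕ} → (∀ i → f i ≤ g i) → sumFin n f ≤ sumFin n g
sumFin-mono-≤ zero    f≤g = z≤n
sumFin-mono-≤ (suc n) f≤g = +-mono-≤ (f≤g zero) (sumFin-mono-≤ n (f≤g ∘ suc))

sumFin-mono-< : ∀ n {f g : Fin n → ℕ} → (∀ i → f i ≤ g i) → ∀ i → f i < g i →
                sumFin n f < sumFin n g
sumFin-mono-< zero    f≤g ()
sumFin-mono-< (suc n) f≤g zero    fi<gi = +-mono-<-≤ fi<gi (sumFin-mono-≤ n (f≤g ∘ suc))
sumFin-mono-< (suc n) f≤g (suc i) fi<gi =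
  +-mono-≤-< (f≤g zero) (sumFin-mono-< n (f≤g ∘ suc) i fi<gi)

sumFin-<-witness : ∀ n {f g : Fin n → ℕ} → sumFin n f < sumFin n g → ∃[ i ] f i < g i
sumFin-<-witness zero    ()
sumFin-<-witness (suc n) {f} {g} lt with f zero <? g zero
... | yes f₀<g₀ = zero , f₀<g₀
... | no  f₀≮g₀ with sumFin-<-witness n {f ∘ suc} {g ∘ suc}
                       (≰⇒> λ tail≤ → <⇒≱ lt (+-mono-≤ (≮⇒≥ f₀≮g₀) tail≤))
...   | i , fi<gi = suc i , fi<gi

sumFin-update : ∀ n {f g : Fin n → ℕ} i → (∀ j → j ≢ i → f j ≡ g j) →
                sumFin n f + g i ≡ sumFin n g + f i
sumFin-update zero    () f≡g
sumFin-update (suc n) {f} {g} zero f≡g =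
  begin
    f zero + sumFin n (f ∘ suc) + g zero
  ≡⟨ cong (λ s → f zero + s + g zero) (sumFin-cong n (λ j → f≡g (suc j) λ ())) ⟩
    f zero + sumFin n (g ∘ suc) + g zero
  ≡⟨ xy∙z≈zy∙x (f zero) _ (g zero) ⟩
    g zero + sumFin n (g ∘ suc) + f zero
  ∎
  where open ≡-Reasoning
sumFin-update (suc n) {f} {g} (suc i) f≡g =
  begin
    f zero + sumFin n (f ∘ suc) + g (suc i)
  ≡⟨ +-assoc (f zero) _ _ ⟩
    f zero + (sumFin n (f ∘ suc) + g (suc i))
  ≡⟨ cong₂ _+_ (f≡g zero λ ())
       (sumFin-update n i λ j j≢i → f≡g (suc j) (j≢i ∘ Fin-suc-injective)) ⟩
    g zero + (sumFin n (g ∘ suc) + f (suc i))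
  ≡⟨ +-assoc (g zero) _ _ ⟨
    g zero + sumFin n (g ∘ suc) + f (suc i)
  ∎
  where open ≡-Reasoning

indicator : Bool → ℕ
indicator true  = 1
indicator false = 0

indicator-< : ∀ {u v} → indicator u < indicator v → u ≡ false × v ≡ true
indicator-< {false} {true}  _         = refl , refl
indicator-< {true}  {true}  (s≤s ())
indicator-< {_}     {false} ()

count≡sumFin : ∀ n (P : Fin n → Bool) → count n P ≡ sumFin n (indicator ∘ P)
count≡sumFin zero    P = refl
count≡sumFin (suc n) P with P zero
... | true  = cong suc (count≡sumFin n (P ∘ suc))
... | false = count≡sumFin n (P ∘ suc)

count-cong : ∀ n {P Q : Fin n → Bool} → (∀ i → P i ≡ Q i) → count n P ≡ count n Q
count-cong n {P} {Q} P≡Q =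
  begin
    count n P                ≡⟨ count≡sumFin n P ⟩
    sumFin n (indicator ∘ P) ≡⟨ sumFin-cong n (cong indicator ∘ P≡Q) ⟩
    sumFin n (indicator ∘ Q) ≡⟨ count≡sumFin n Q ⟨
    count n Q                ∎
  where open ≡-Reasoning

count-<-witness : ∀ n {P Q : Fin n → Bool} → count n P < count n Q →
                  ∃[ i ] P i ≡ false × Q i ≡ true
count-<-witness n {P} {Q} lt
  with sumFin-<-witness n (subst₂ _<_ (count≡sumFin n P) (count≡sumFin n Q) lt)
... | i , Pi<Qi = i , indicator-< Pi<Qi

count-insert : ∀ n {P Q : Fin n → Bool} i → (∀ j → j ≢ i → P j ≡ Q j) →
               P i ≡ false → Q i ≡ true → count n Q ≡ suc (count n P)
count-insert n {P} {Q} i P≡Q Pi Qi =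
  begin
    count n Q                                  ≡⟨ count≡sumFin n Q ⟩
    sumFin n (indicator ∘ Q)                   ≡⟨ +-identityʳ _ ⟨
    sumFin n (indicator ∘ Q) + 0               ≡⟨ cong (λ u → _ + indicator u) Pi ⟨
    sumFin n (indicator ∘ Q) + indicator (P i) ≡⟨ sumFin-update n i (λ j → cong indicator ∘ P≡Q j) ⟨
    sumFin n (indicator ∘ P) + indicator (Q i) ≡⟨ cong (λ u → _ + indicator u) Qi ⟩
    sumFin n (indicator ∘ P) + 1               ≡⟨ +-comm _ 1 ⟩
    suc (sumFin n (indicator ∘ P))             ≡⟨ cong suc (count≡sumFin n P) ⟨
    suc (count n P)                            ∎
  where open ≡-Reasoning

n<m⇒m∸n≡suc[m∸[1+n]] : ∀ {m n} → n < m → m ∸ n ≡ suc (m ∸ suc n)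
n<m⇒m∸n≡suc[m∸[1+n]] {suc m} {zero}  _         = refl
n<m⇒m∸n≡suc[m∸[1+n]] {suc m} {suc n} (s≤s n<m) = n<m⇒m∸n≡suc[m∸[1+n]] n<m

m∸n≤suc[m∸[1+n]] : ∀ m n → m ∸ n ≤ suc (m ∸ suc n)
m∸n≤suc[m∸[1+n]] zero    n       = ≤-trans (m∸n≤m 0 n) z≤n
m∸n≤suc[m∸[1+n]] (suc m) zero    = ≤-refl
m∸n≤suc[m∸[1+n]] (suc m) (suc n) = m∸n≤suc[m∸[1+n]] m n

m∸o<m∸n⇒n<m×n<o : ∀ m {n o} → m ∸ o < m ∸ n → n < m × n < o
m∸o<m∸n⇒n<m×n<o m {n} {o} lt =
  ≰⇒> (λ m≤n → n≮0 (subst (m ∸ o <_) (m≤n⇒m∸n≡0 m≤n) lt)) ,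
  ≰⇒> (λ o≤n → <⇒≱ lt (∸-monoʳ-≤ m o≤n))

deficit : (n : ℕ) → (Fin n → ℕ) → (Fin n → ℕ) → ℕ
deficit n q d = sumFin n (λ i → q i ∸ d i)

deficit-antitone : ∀ n q {d d' : Fin n → ℕ} → (∀ i → d i ≤ d' i) → deficit n q d' ≤ deficit n q d
deficit-antitone n q d≤d' = sumFin-mono-≤ n (λ i → ∸-monoʳ-≤ (q i) (d≤d' i))

deficit-<-witness : ∀ n q {d d' : Fin n → ℕ} → deficit n q d' < deficit n q d →
                    ∃[ i ] d i < q i × d i < d' i
deficit-<-witness n q lt with sumFin-<-witness n lt
... | i , lt-at-i = i , m∸o<m∸n⇒n<m×n<o (q i) lt-at-i

module _ (n : ℕ) (q : Fin n → ℕ) {d d' : Fin n → ℕ} (i : Fin n)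
         (d'i≡1+di : d' i ≡ suc (d i)) (d'≡d : ∀ j → j ≢ i → d' j ≡ d j) where

  private
    deficit-shift : deficit n q d + (q i ∸ suc (d i)) ≡ deficit n q d' + (q i ∸ d i)
    deficit-shift =
      subst (λ t → deficit n q d + (q i ∸ t) ≡ deficit n q d' + (q i ∸ d i)) d'i≡1+di
        (sumFin-update n i (λ j j≢i → cong (q j ∸_) (sym (d'≡d j j≢i))))

  deficit-increment-below : d i < q i → deficit n q d ≡ suc (deficit n q d')
  deficit-increment-below di<qi = +-cancelʳ-≡ (q i ∸ suc (d i)) _ _
    (trans deficit-shift
      (trans (cong (deficit n q d' +_) (n<m⇒m∸n≡suc[m∸[1+n]] di<qi)) (+-suc _ _)))

  deficit-increment-≤ : deficit n q d ≤ suc (deficit n q d')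
  deficit-increment-≤ = +-cancelʳ-≤ (q i ∸ suc (d i)) _ _
    (≤-trans (≤-reflexive deficit-shift)
      (≤-trans (+-monoʳ-≤ (deficit n q d') (m∸n≤suc[m∸[1+n]] (q i) (d i)))
               (≤-reflexive (+-suc _ _))))

_[_,_]≔_ : ∀ {nA nB} → EdgeSet nA nB → Fin nA → Fin nB → Bool → EdgeSet nA nB
(M [ a , b ]≔ v) x y = if does (x ≟ a) ∧ does (y ≟ b) then v else M x y

module _ {nA nB} (M : EdgeSet nA nB) (a : Fin nA) (b : Fin nB) (v : Bool) where

  update-≡ : (M [ a , b ]≔ v) a b ≡ v
  update-≡ with a ≟ a | b ≟ b
  ... | yes _ | yes _ = refl
  ... | no a≢a | _     = ⊥-elim (a≢a refl)
  ... | yes _ | no b≢b = ⊥-elim (b≢b refl)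

  update-≢ˡ : ∀ {x} y → x ≢ a → (M [ a , b ]≔ v) x y ≡ M x y
  update-≢ˡ {x} y x≢a with x ≟ a
  ... | yes x≡a = ⊥-elim (x≢a x≡a)
  ... | no _    = refl

  update-≢ʳ : ∀ x {y} → y ≢ b → (M [ a , b ]≔ v) x y ≡ M x y
  update-≢ʳ x {y} y≢b with x ≟ a | y ≟ b
  ... | _     | yes y≡b = ⊥-elim (y≢b y≡b)
  ... | yes _ | no _    = refl
  ... | no _  | no _    = refl

  degA-update-≢ : ∀ {x} → x ≢ a → degA (M [ a , b ]≔ v) x ≡ degA M x
  degA-update-≢ x≢a = count-cong _ (λ y → update-≢ˡ y x≢a)

  degB-update-≢ : ∀ {y} → y ≢ b → degB (M [ a , b ]≔ v) y ≡ degB M y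
  degB-update-≢ y≢b = count-cong _ (λ x → update-≢ʳ x y≢b)

module _ {nA nB} (M : EdgeSet nA nB) (a : Fin nA) (b : Fin nB) where

  degA-insert : M a b ≡ false → degA (M [ a , b ]≔ true) a ≡ suc (degA M a)
  degA-insert Mab≡false =
    count-insert nB b (λ y y≢b → sym (update-≢ʳ M a b true a y≢b)) Mab≡false (update-≡ M a b true)

  degB-insert : M a b ≡ false → degB (M [ a , b ]≔ true) b ≡ suc (degB M b)
  degB-insert Mab≡false =
    count-insert nA a (λ x x≢a → sym (update-≢ˡ M a b true b x≢a)) Mab≡false (update-≡ M a b true)

  degA-remove : M a b ≡ true → degA M a ≡ suc (degA (M [ a , b ]≔ false) a)
  degA-remove Mab≡true =
    count-insert nB b (λ y y≢b → update-≢ʳ M a b false a y≢b) (update-≡ M a b false) Mab≡true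

  degB-remove : M a b ≡ true → degB M b ≡ suc (degB (M [ a , b ]≔ false) b)
  degB-remove Mab≡true =
    count-insert nA a (λ x x≢a → update-≢ˡ M a b false b x≢a) (update-≡ M a b false) Mab≡true

update-⊆ : ∀ {nA nB} {E M : EdgeSet nA nB} {a b v} →
           (∀ x y → T (M x y) → T (E x y)) → (T v → T (E a b)) →
           ∀ x y → T ((M [ a , b ]≔ v) x y) → T (E x y)
update-⊆ {a = a} {b} M⊆E v⊆E x y with x ≟ a | y ≟ b
... | yes refl | yes refl = v⊆E
... | yes _    | no _     = M⊆E x y
... | no _     | _        = M⊆E x y

hamming : ∀ {nA nB} → EdgeSet nA nB → EdgeSet nA nB → ℕ
hamming {nA} {nB} M N = sumFin nA (λ x → count nB (λ y → M x y xor N x y))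

hamming-update-< : ∀ {nA nB} (M N : EdgeSet nA nB) a b {v} → M a b ≡ not v → N a b ≡ v →
                   hamming (M [ a , b ]≔ v) N < hamming M N
hamming-update-< {nA} {nB} M N a b {v} Mab≡¬v Nab≡v = sumFin-mono-< nA rows-≤ a row-a-<
  where
  row-a-< : count nB (λ y → (M [ a , b ]≔ v) a y xor N a y) < count nB (λ y → M a y xor N a y)
  row-a-< = ≤-reflexive (sym (count-insert nB b
    (λ y y≢b → cong (_xor N a y) (update-≢ʳ M a b v a y≢b))
    (trans (cong₂ _xor_ (update-≡ M a b v) Nab≡v) (xor-same v))
    (trans (cong₂ _xor_ Mab≡¬v Nab≡v) (xor-inverseˡ v))))
  rows-≤ : ∀ x → count nB (λ y → (M [ a , b ]≔ v) x y xor N x y) ≤ count nB (λ y → M x y xor N x y)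
  rows-≤ x = by-cases (x ≟ a)
    where
    by-cases : Dec (x ≡ a) →
               count nB (λ y → (M [ a , b ]≔ v) x y xor N x y) ≤ count nB (λ y → M x y xor N x y)
    by-cases (yes refl) = <⇒≤ row-a-<
    by-cases (no x≢a)   =
      ≤-reflexive (count-cong nB (λ y → cong (_xor N x y) (update-≢ˡ M a b v y x≢a)))

exchange : ∀ {nA nB} → EdgeSet nA nB → Fin nA → Fin nA → Fin nB → EdgeSet nA nB
exchange M a a' b = (M [ a , b ]≔ true) [ a' , b ]≔ false

module Exchange {nA nB} (M : EdgeSet nA nB) (a a' : Fin nA) (b : Fin nB)
         (Mab≡false : M a b ≡ false) (Ma'b≡true : M a' b ≡ true) where

  private
    M⁺ : EdgeSet nA nB
    M⁺ = M [ a , b ]≔ true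

    a'≢a : a' ≢ a
    a'≢a refl with trans (sym Mab≡false) Ma'b≡true
    ... | ()

    M⁺a'b≡true : M⁺ a' b ≡ true
    M⁺a'b≡true = trans (update-≢ˡ M a b true b a'≢a) Ma'b≡true

  degA-exchange-added : degA (exchange M a a' b) a ≡ suc (degA M a)
  degA-exchange-added =
    trans (degA-update-≢ M⁺ a' b false (a'≢a ∘ sym)) (degA-insert M a b Mab≡false)

  degA-exchange-removed : suc (degA (exchange M a a' b) a') ≡ degA M a'
  degA-exchange-removed =
    trans (sym (degA-remove M⁺ a' b M⁺a'b≡true)) (degA-update-≢ M a b true a'≢a)

  degA-exchange-≢ : ∀ {x} → x ≢ a → x ≢ a' → degA (exchange M a a' b) x ≡ degA M x
  degA-exchange-≢ x≢a x≢a' = trans (degA-update-≢ M⁺ a' b false x≢a') (degA-update-≢ M a b true x≢a)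

  deficit-exchange-≤ : ∀ q → degA M a < q a →
                       deficit nA q (degA (exchange M a a' b)) ≤ deficit nA q (degA M)
  deficit-exchange-≤ q a-deficient =
    ≤-trans
      (deficit-increment-≤ nA q a' (degA-remove M⁺ a' b M⁺a'b≡true)
        (λ x x≢a' → sym (degA-update-≢ M⁺ a' b false x≢a')))
      (≤-reflexive (sym (deficit-increment-below nA q a (degA-insert M a b Mab≡false)
        (λ x x≢a → degA-update-≢ M a b true x≢a) a-deficient)))

  degB-exchange : ∀ y → degB (exchange M a a' b) y ≡ degB M y
  degB-exchange y = by-cases (y ≟ b)
    where
    by-cases : Dec (y ≡ b) → degB (exchange M a a' b) y ≡ degB M y
    by-cases (yes refl) =
      suc-injective (trans (sym (degB-remove M⁺ a' b M⁺a'b≡true)) (degB-insert M a b Mab≡false))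
    by-cases (no y≢b) = trans (degB-update-≢ M⁺ a' b false y≢b) (degB-update-≢ M a b true y≢b)

  hamming-exchange-< : ∀ {N} → N a b ≡ true → N a' b ≡ false →
                       hamming (exchange M a a' b) N < hamming M N
  hamming-exchange-< {N} Nab≡true Na'b≡false =
    <-trans (hamming-update-< M⁺ N a' b M⁺a'b≡true Na'b≡false)
            (hamming-update-< M N a b Mab≡false Nab≡true)

module _ {nA nB} (G : Instance nA nB) where
  open Instance G
  open IsMatching

  augment-Def-< : ∀ {M a b} → M a b ≡ false → degA M a < q⁻A a → Def G (M [ a , b ]≔ true) < Def G M
  augment-Def-< {M} {a} {b} Mab≡false a-deficient =
    +-mono-<-≤
      (≤-reflexive (sym (deficit-increment-below nA q⁻A a (degA-insert M a b Mab≡false)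
        (λ x x≢a → degA-update-≢ M a b true x≢a) a-deficient)))
      (deficit-antitone nB q⁻B (λ y → degB-≤ y (y ≟ b)))
    where
    degB-≤ : ∀ y → Dec (y ≡ b) → degB M y ≤ degB (M [ a , b ]≔ true) y
    degB-≤ y (yes refl) = ≤-trans (n≤1+n _) (≤-reflexive (sym (degB-insert M a b Mab≡false)))
    degB-≤ y (no y≢b)   = ≤-reflexive (sym (degB-update-≢ M a b true y≢b))

  exchange-DefB-≡ : ∀ {M a a' b} → M a b ≡ false → M a' b ≡ true →
                    DefB G (exchange M a a' b) ≡ DefB G M
  exchange-DefB-≡ {M} {a} {a'} {b} Mab≡false Ma'b≡true =
    sumFin-cong nB (λ y → cong (q⁻B y ∸_) (degB-exchange y))
    where open Exchange M a a' b Mab≡false Ma'b≡true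

  IsCritical-by-Def : ∀ {M M'} → IsCritical G M → IsMatching G M' → Def G M' ≡ Def G M →
                      IsCritical G M'
  IsCritical-by-Def M-critical M'-matching Def≡ = record
    { matching = M'-matching
    ; minimal  = λ N N-matching N<M' →
        IsCritical.minimal M-critical N N-matching (subst (Def G N <_) Def≡ N<M') }

  module _ (W : WellQuoted G) where
    open WellQuoted W

    augment-IsMatching : ∀ {M a b} → IsMatching G M → M a b ≡ false → T (E a b) →
                         degA M a < q⁻A a → degB M b < q⁺B b → IsMatching G (M [ a , b ]≔ true)
    augment-IsMatching {M} {a} {b} M-matching Mab≡false Eab a-deficient b-unsaturated = record
      { ⊆E   = update-⊆ (⊆E M-matching) (const Eab)
      ; capA = λ x → capA-at x (x ≟ a)
      ; capB = λ y → capB-at y (y ≟ b)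
      }
      where
      capA-at : ∀ x → Dec (x ≡ a) → degA (M [ a , b ]≔ true) x ≤ q⁺A x
      capA-at x (yes refl) =
        ≤-trans (≤-reflexive (degA-insert M a b Mab≡false)) (≤-trans a-deficient (lowA≤upA a))
      capA-at x (no x≢a) = ≤-trans (≤-reflexive (degA-update-≢ M a b true x≢a)) (capA M-matching x)
      capB-at : ∀ y → Dec (y ≡ b) → degB (M [ a , b ]≔ true) y ≤ q⁺B y
      capB-at y (yes refl) = ≤-trans (≤-reflexive (degB-insert M a b Mab≡false)) b-unsaturated
      capB-at y (no y≢b) = ≤-trans (≤-reflexive (degB-update-≢ M a b true y≢b)) (capB M-matching y)

    exchange-IsMatching : ∀ {M a a' b} → IsMatching G M → M a b ≡ false → M a' b ≡ true →
                          T (E a b) → degA M a < q⁻A a → IsMatching G (exchange M a a' b)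
    exchange-IsMatching {M} {a} {a'} {b} M-matching Mab≡false Ma'b≡true Eab a-deficient = record
      { ⊆E   = update-⊆ (update-⊆ (⊆E M-matching) (const Eab)) (λ ())
      ; capA = λ x → capA-at x (x ≟ a) (x ≟ a')
      ; capB = λ y → ≤-trans (≤-reflexive (degB-exchange y)) (capB M-matching y)
      }
      where
      open Exchange M a a' b Mab≡false Ma'b≡true
      capA-at : ∀ x → Dec (x ≡ a) → Dec (x ≡ a') → degA (exchange M a a' b) x ≤ q⁺A x
      capA-at x (yes refl) _ =
        ≤-trans (≤-reflexive degA-exchange-added)
                (≤-trans a-deficient (lowA≤upA a))
      capA-at x (no _) (yes refl) =
        ≤-trans (n≤1+n _)
                (≤-trans (≤-reflexive degA-exchange-removed) (capA M-matching x))
      capA-at x (no x≢a) (no x≢a') =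
        ≤-trans (≤-reflexive (degA-exchange-≢ x≢a x≢a')) (capA M-matching x)

    module _ {N : EdgeSet nA nB} (N-matching : IsMatching G N) where

      private
        DescentFrom : EdgeSet nA nB → Set
        DescentFrom M = ∃[ M' ] IsCritical G M' × DefA G M' ≡ DefA G M × hamming M' N < hamming M N

        edge : ∀ {x y} → N x y ≡ true → T (E x y)
        edge {x} {y} Nxy≡true = ⊆E N-matching x y (subst T (sym Nxy≡true) tt)

      exchange-descent : ∀ {M a a' b} → IsCritical G M → degA M a < q⁻A a →
                         M a b ≡ false → N a b ≡ true → M a' b ≡ true → N a' b ≡ false →
                         DescentFrom M
      exchange-descent {M} {a} {a'} {b} M-critical a-deficient Mab≡false Nab≡true Ma'b≡true Na'b≡false =
        [ (λ DefA< → ⊥-elim (IsCritical.minimal M-critical M' M'-matching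
                               (+-mono-<-≤ DefA< (≤-reflexive DefB≡))))
        , (λ DefA≡ → M' , IsCritical-by-Def M-critical M'-matching (cong₂ _+_ DefA≡ DefB≡) ,
                     DefA≡ , hamming-exchange-< Nab≡true Na'b≡false)
        ]′ (m≤n⇒m<n∨m≡n (deficit-exchange-≤ q⁻A a-deficient))
        where
        open Exchange M a a' b Mab≡false Ma'b≡true
        M' : EdgeSet nA nB
        M' = exchange M a a' b
        M'-matching : IsMatching G M'
        M'-matching = exchange-IsMatching (IsCritical.matching M-critical)
                        Mab≡false Ma'b≡true (edge Nab≡true) a-deficient
        DefB≡ : DefB G M' ≡ DefB G M
        DefB≡ = exchange-DefB-≡ Mab≡false Ma'b≡true

      critical-descent : ∀ {M} → IsCritical G M → DefA G N < DefA G M → DescentFrom M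
      critical-descent {M} M-critical N<M with deficit-<-witness nA q⁻A N<M
      ... | a , a-deficient , a-short with count-<-witness nB a-short
      ... | b , Mab≡false , Nab≡true with degB M b <? q⁺B b
      ... | yes b-unsaturated =
        ⊥-elim (IsCritical.minimal M-critical _
                  (augment-IsMatching (IsCritical.matching M-critical) Mab≡false (edge Nab≡true)
                                      a-deficient b-unsaturated)
                  (augment-Def-< Mab≡false a-deficient))
      ... | no b-saturated
        with count-<-witness nA {λ x → N x b} {λ x → (M [ a , b ]≔ true) x b}
               (≤-trans (s≤s (≤-trans (capB N-matching b) (≮⇒≥ b-saturated)))
                        (≤-reflexive (sym (degB-insert M a b Mab≡false))))
      ... | a' , Na'b≡false , M⁺a'b≡true =
        exchange-descent M-critical a-deficient Mab≡false Nab≡true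
          (trans (sym (update-≢ˡ M a b true b a'≢a)) M⁺a'b≡true) Na'b≡false
        where
        a'≢a : a' ≢ a
        a'≢a refl with trans (sym Nab≡true) Na'b≡false
        ... | ()

      critical-DefA-≤ : ∀ {M} → IsCritical G M → DefA G M ≤ DefA G N
      critical-DefA-≤ {M} = go M (<-wellFounded (hamming M N))
        where
        go : ∀ M → Acc _<_ (hamming M N) → IsCritical G M → DefA G M ≤ DefA G N
        go M (acc rec) M-critical with DefA G M ≤? DefA G N
        ... | yes M≤N = M≤N
        ... | no  M≰N with critical-descent M-critical (≰⇒> M≰N)
        ...   | M' , M'-critical , DefA≡ , closer =
          subst (_≤ DefA G N) DefA≡ (go M' (rec closer) M'-critical)

transposeᴵ : ∀ {nA nB} → Instance nA nB → Instance nB nA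
transposeᴵ G = record
  { E = λ b a → E a b ; q⁻A = q⁻B ; q⁺A = q⁺B ; q⁻B = q⁻A ; q⁺B = q⁺A }
  where open Instance G

transpose : ∀ {nA nB} → EdgeSet nA nB → EdgeSet nB nA
transpose M b a = M a b

WellQuoted-transpose : ∀ {nA nB} {G : Instance nA nB} → WellQuoted G → WellQuoted (transposeᴵ G)
WellQuoted-transpose W = record
  { lowA≤upA = lowB≤upB ; lowB≤upB = lowA≤upA ; upA-pos = upB-pos ; upB-pos = upA-pos }
  where open WellQuoted W

IsMatching-transpose : ∀ {nA nB} {G : Instance nA nB} {M} → IsMatching G M →
                       IsMatching (transposeᴵ G) (transpose M)
IsMatching-transpose M-matching = record
  { ⊆E = λ b a → ⊆E a b ; capA = capB ; capB = capA }
  where open IsMatching M-matching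

-- transposeᴵ (transposeᴵ G) is G up to η, so IsMatching-transpose also carries
-- matchings of the transposed instance back to G.
IsCritical-transpose : ∀ {nA nB} {G : Instance nA nB} {M} → IsCritical G M →
                       IsCritical (transposeᴵ G) (transpose M)
IsCritical-transpose {G = G} {M} M-critical = record
  { matching = IsMatching-transpose matching
  ; minimal  = λ N N-matching N<M →
      minimal (transpose N) (IsMatching-transpose N-matching)
        (subst₂ _<_ (+-comm (DefB G (transpose N)) _) (+-comm (DefB G M) _) N<M)
  }
  where open IsCritical M-critical

claim1 : ∀ {nA nB : ℕ} (G : Instance nA nB) → WellQuoted G →
         (N₁ N₂ : EdgeSet nA nB) → IsCritical G N₁ → IsMatching G N₂ →
         (DefA G N₁ ≤ DefA G N₂) × (DefB G N₁ ≤ DefB G N₂)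
claim1 G W N₁ N₂ N₁-critical N₂-matching =
  critical-DefA-≤ G W N₂-matching N₁-critical ,
  critical-DefA-≤ (transposeᴵ G) (WellQuoted-transpose W)
    (IsMatching-transpose N₂-matching) (IsCritical-transpose N₁-critical)
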